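{- Let $G$ be a DAG on an $n$-element set $X$ and $L$ a linear order on $X$ compatible with $G$. Run the sorting phase of UniTopSort: push all items of $X$ in a fixed topological order of $G$ into an initially empty heap with the unified bound, then pop $n$ times. For $x \in X$ let $a(x) \in [1,n]$ be such that $x$ is the $a(x)$-th item pushed and $b(x) \in [1,n]$ such that $x$ is the $b(x)$-th item popped; let $r(x) = a(x) + b(x)$ and $\ell(x) = \max\big(0, \max_{y:\, a(y) < a(x),\, b(y) < b(x)} (a(y) + b(y))\big)$ (the inner maximum being omitted if no such $y$ exists). Then the operation $x \gets \texttt{pop}()$ has amortized running time $O(1 + \log(r(x) - \ell(x)))$.
   Context: A linear order $L$ on $X$ is compatible with $G$ if $x <_L y$ for every edge $x \to y$. A heap maintains a set of comparable items under $\texttt{push}(x)$ and $x \gets \texttt{pop}()$ (remove and return the smallest item, here with respect to $L$). It has the unified bound if, for any sequence of operations starting from empty, with pushed items $X$, $x$ the $a(x)$-th pushed and $b(x)$-th popped item ($b(x)=\infty$ if never popped), $\texttt{push}$ takes amortized $O(1)$ time, the first $\texttt{pop}$ amortized $O(1)$ time, and each subsequent $x \gets \texttt{pop}()$ amortized $O\big(\min_{y \in X:\ b(y) < b(x)} (1 + \log |a(x) - a(y)| + \log (b(x) - b(y)))\big)$ time. Logarithms are base 2. -}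

module Defs where

open import Data.Nat using (ℕ; zero; suc; _+_; _*_; _∸_; _⊔_; _⊓_; _<ᵇ_; _≤ᵇ_; ∣_-_∣)
open import Data.Nat.Logarithm using (⌊log₂_⌋)
open import Data.Fin using (Fin; toℕ)
open import Data.List using (List; []; _∷_; foldr; allFin)
open import Data.Bool using (Bool; true; false; if_then_else_; _∧_)
open import Data.Maybe using (Maybe; just; nothing; maybe)

-- A run of the sorting phase is described by
--   a : Fin n → Fin n   (0-based push rank;  a(x) in the paper is  toℕ (a x) + 1)
--   b : Fin n → Fin n   (0-based pop rank;   b(x) in the paper is  toℕ (b x) + 1)
-- (both bijections, i.e. injective maps on Fin n).

rank : ∀ {n} → (Fin n → Fin n) → Fin n → ℕ
rank a x = suc (toℕ (a x))

Σ[_∣_] : ∀ {n} → (Fin n → Bool) → (Fin n → ℕ) → ℕ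
Σ[_∣_] {n} P f = foldr (λ x acc → if P x then f x + acc else acc) 0 (allFin n)

minᴹ : List ℕ → Maybe ℕ
minᴹ [] = nothing
minᴹ (m ∷ ms) = maybe (λ k → just (m ⊓ k)) (just m) (minᴹ ms)

ubTerm : ∀ {n} → (a b : Fin n → Fin n) → Fin n → Fin n → ℕ
ubTerm a b x y = 1 + ⌊log₂ ∣ rank a x - rank a y ∣ ⌋ + ⌊log₂ (rank b x ∸ rank b y) ⌋

-- Amortized cost of  x ← pop()  granted by the unified bound:
--   min over y with b(y) < b(x) of ubTerm; for the first pop (no such y) it is 1 (= O(1)).
ubPop : ∀ {n} → (a b : Fin n → Fin n) → Fin n → ℕ
ubPop {n} a b x =
  maybe (λ m → m) 1
    (minᴹ (foldr (λ y acc → if rank b y <ᵇ rank b x then ubTerm a b x y ∷ acc else acc)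
                 [] (allFin n)))

ℓ : ∀ {n} → (a b : Fin n → Fin n) → Fin n → ℕ
ℓ {n} a b x =
  foldr (λ y acc → if (rank a y <ᵇ rank a x) ∧ (rank b y <ᵇ rank b x)
                   then (rank a y + rank b y) ⊔ acc else acc)
        0 (allFin n)

r : ∀ {n} → (a b : Fin n → Fin n) → Fin n → ℕ
r a b x = rank a x + rank b x

newPop : ∀ {n} → (a b : Fin n → Fin n) → Fin n → ℕ
newPop a b x = 1 + ⌊log₂ (r a b x ∸ ℓ a b x) ⌋

poppedBy : ∀ {n} → (b : Fin n → Fin n) → ℕ → Fin n → Bool
poppedBy b k x = rank b x ≤ᵇ k

{-# OPTIONS --safe #-}
-- If some y was pushed and popped before x, take the one attaining ℓ(x): then r(x) − ℓ(x) =
-- (a(x) − a(y)) + (b(x) − b(y)), so y witnesses a unified-bound term of at most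
-- 1 + 2 log (r(x) − ℓ(x)). Otherwise ℓ(x) = 0 and every witness costs at most
-- 1 + log n + log b(x) ≤ 1 + log n + log r(x). The excess log n − log b(x), summed over
-- the distinct pop ranks b(x), is O(n) and is absorbed by the additive n.
module Submission where

open import Defs
open import Algebra.Properties.CommutativeSemigroup using (interchange)
open import Data.Bool using (Bool; true; false; T; if_then_else_; _∧_)
open import Data.Bool.Properties using (T-∧)
open import Data.Empty using (⊥-elim)
open import Data.Fin using (Fin; toℕ; _<_)
open import Data.Fin.Properties using (toℕ<n; toℕ-injective)
open import Data.List using (List; []; _∷_; foldr; allFin)
open import Data.List.Membership.Propositional using (_∈_)
open import Data.List.Membership.Propositional.Properties using (∈-allFin)
open import Data.List.Relation.Unary.All as All using (All; []; _∷_)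
open import Data.List.Relation.Unary.AllPairs using (_∷_)
open import Data.List.Relation.Unary.Any using (here; there)
open import Data.List.Relation.Unary.Unique.Propositional using (Unique; [])
open import Data.List.Relation.Unary.Unique.Propositional.Properties using (allFin⁺)
open import Data.Maybe using (Maybe; just; nothing; fromMaybe)
open import Data.Maybe.Relation.Unary.Any as Maybe using (just)
open import Data.Nat
  using ( ℕ; zero; suc; _≤_; _+_; _*_; _∸_; _^_; _⊔_; _<ᵇ_; _≡ᵇ_; ∣_-_∣; ⌊_/2⌋; ⌈_/2⌉
        ; z≤n; s≤s; z<s)
  renaming (_<_ to _<ℕ_)
open import Data.Nat.Induction using (<-rec)
open import Data.Nat.Logarithm
  using (⌊log₂_⌋; ⌊log₂⌋-mono-≤; ⌊log₂[2^n]⌋≡n; ⌊log₂⌊n/2⌋⌋≡⌊log₂n⌋∸1)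
open import Data.Nat.Properties
open import Data.Nat.Tactic.RingSolver using (solve-∀)
open import Data.Product using (∃; ∃-syntax; _×_; _,_)
open import Data.Sum using (_⊎_; inj₁; inj₂)
open import Function.Bundles using (Equivalence)
open import Function.Definitions using (Injective)
open import Relation.Binary.PropositionalEquality
open import Relation.Nullary using (¬_)

𝟙 : Bool → ℕ
𝟙 true  = 1
𝟙 false = 0

𝟙-¬T : ∀ {b} → ¬ T b → 𝟙 b ≡ 0
𝟙-¬T {false} _  = refl
𝟙-¬T {true}  ¬t = ⊥-elim (¬t _)

𝟙[<ᵇ1+] : ∀ t m → 𝟙 (t <ᵇ suc m) ≡ 𝟙 (t <ᵇ m) + 𝟙 (t ≡ᵇ m)
𝟙[<ᵇ1+] zero    zero    = refl
𝟙[<ᵇ1+] zero    (suc m) = refl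
𝟙[<ᵇ1+] (suc t) zero    = refl
𝟙[<ᵇ1+] (suc t) (suc m) = 𝟙[<ᵇ1+] t m

module _ {a} {A : Set a} where

  sumWhere : (A → Bool) → (A → ℕ) → List A → ℕ
  sumWhere P f = foldr (λ x acc → if P x then f x + acc else acc) 0

  sumWhere-mono-≤ : ∀ P {f g} → (∀ x → f x ≤ g x) →
                    ∀ xs → sumWhere P f xs ≤ sumWhere P g xs
  sumWhere-mono-≤ P f≤g []       = z≤n
  sumWhere-mono-≤ P f≤g (x ∷ xs) with P x
  ... | true  = +-mono-≤ (f≤g x) (sumWhere-mono-≤ P f≤g xs)
  ... | false = sumWhere-mono-≤ P f≤g xs

  sumWhere-+ : ∀ P f g xs →
               sumWhere P (λ x → f x + g x) xs ≡ sumWhere P f xs + sumWhere P g xs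
  sumWhere-+ P f g []       = refl
  sumWhere-+ P f g (x ∷ xs) with P x
  ... | true  = trans (cong (f x + g x +_) (sumWhere-+ P f g xs))
                      (interchange +-commutativeSemigroup (f x) (g x) _ _)
  ... | false = sumWhere-+ P f g xs

  sumWhere-zero : ∀ P {f xs} → All (λ x → f x ≡ 0) xs → sumWhere P f xs ≡ 0
  sumWhere-zero P []                          = refl
  sumWhere-zero P {xs = x ∷ _} (fx≡0 ∷ f≡0) with P x
  ... | true  = cong₂ _+_ fx≡0 (sumWhere-zero P f≡0)
  ... | false = sumWhere-zero P f≡0

  mapWhere : ∀ {b} {B : Set b} → (A → Bool) → (A → B) → List A → List B
  mapWhere P g = foldr (λ y acc → if P y then g y ∷ acc else acc) []

  ∈-mapWhere⁺ : ∀ {b} {B : Set b} {P} {g : A → B} {y xs} →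
                y ∈ xs → T (P y) → g y ∈ mapWhere P g xs
  ∈-mapWhere⁺ {P = P} {y = y} (here refl) Py with P y
  ... | true = here refl
  ∈-mapWhere⁺ {P = P} {xs = x ∷ _} (there y∈xs) Py with P x
  ... | true  = there (∈-mapWhere⁺ y∈xs Py)
  ... | false = ∈-mapWhere⁺ y∈xs Py

  All-mapWhere⁺ : ∀ {b q} {B : Set b} {Q : B → Set q} {P} {g : A → B} →
                  (∀ y → Q (g y)) → ∀ xs → All Q (mapWhere P g xs)
  All-mapWhere⁺         Qg []       = []
  All-mapWhere⁺ {P = P} Qg (x ∷ xs) with P x
  ... | true  = Qg x ∷ All-mapWhere⁺ Qg xs
  ... | false = All-mapWhere⁺ Qg xs

  maxWhere : (A → Bool) → (A → ℕ) → List A → ℕ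
  maxWhere P w = foldr (λ y acc → if P y then w y ⊔ acc else acc) 0

  maxWhere≡0⊎attained : ∀ P w xs →
                        maxWhere P w xs ≡ 0 ⊎ ∃[ y ] (T (P y) × maxWhere P w xs ≡ w y)
  maxWhere≡0⊎attained P w []       = inj₁ refl
  maxWhere≡0⊎attained P w (x ∷ xs) with P x in Px | maxWhere≡0⊎attained P w xs
  ... | false | rest = rest
  ... | true  | inj₁ rest≡0 =
    inj₂ (x , subst T (sym Px) _ , trans (cong (w x ⊔_) rest≡0) (⊔-identityʳ (w x)))
  ... | true  | inj₂ (y , Py , rest≡wy) with ⊔-sel (w x) (maxWhere P w xs)
  ...   | inj₁ max≡wx   = inj₂ (x , subst T (sym Px) _ , max≡wx)
  ...   | inj₂ max≡rest = inj₂ (y , Py , trans max≡rest rest≡wy)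

fromMaybe-≤ : ∀ d {m} {mk : Maybe ℕ} → Maybe.Any (_≤ m) mk → fromMaybe d mk ≤ m
fromMaybe-≤ d (just k≤m) = k≤m

minᴹ-≤-∈ : ∀ {m ms} → m ∈ ms → Maybe.Any (_≤ m) (minᴹ ms)
minᴹ-≤-∈ {m} {_ ∷ ms} (here refl) with minᴹ ms
... | nothing = just ≤-refl
... | just k  = just (m⊓n≤m m k)
minᴹ-≤-∈ {m} {m′ ∷ ms} (there m∈ms) with minᴹ ms | minᴹ-≤-∈ m∈ms
... | just k | just k≤m = just (≤-trans (m⊓n≤n m′ k) k≤m)

fromMaybe-minᴹ-≤ : ∀ {d B} ms → d ≤ B → All (_≤ B) ms → fromMaybe d (minᴹ ms) ≤ B
fromMaybe-minᴹ-≤ []       d≤B []        = d≤B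
fromMaybe-minᴹ-≤ (m ∷ ms) _   (m≤B ∷ _) =
  ≤-trans (fromMaybe-≤ _ (minᴹ-≤-∈ {ms = m ∷ ms} (here refl))) m≤B

2^k≤n⇒k≤⌊log₂n⌋ : ∀ {k n} → 2 ^ k ≤ n → k ≤ ⌊log₂ n ⌋
2^k≤n⇒k≤⌊log₂n⌋ {k} 2^k≤n = subst (_≤ _) (⌊log₂[2^n]⌋≡n k) (⌊log₂⌋-mono-≤ 2^k≤n)

2^⌊log₂n⌋≤n : ∀ n → 0 <ℕ n → 2 ^ ⌊log₂ n ⌋ ≤ n
2^⌊log₂n⌋≤n = <-rec (λ n → 0 <ℕ n → 2 ^ ⌊log₂ n ⌋ ≤ n) bound
  where
  bound : ∀ n → (∀ {m} → m <ℕ n → 0 <ℕ m → 2 ^ ⌊log₂ m ⌋ ≤ m) →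
          0 <ℕ n → 2 ^ ⌊log₂ n ⌋ ≤ n
  bound 1                  _   _ = ≤-refl
  bound n@(suc (suc n-2)) rec _ = begin
    2 ^ ⌊log₂ n ⌋      ≡⟨ cong (2 ^_) ⌊log₂n⌋≡1+⌊log₂h⌋ ⟩
    2 * 2 ^ ⌊log₂ h ⌋  ≤⟨ *-monoʳ-≤ 2 (rec (⌊n/2⌋<n (suc n-2)) z<s) ⟩
    h + (h + 0)        ≡⟨ cong (h +_) (+-identityʳ h) ⟩
    h + h              ≤⟨ +-monoʳ-≤ h (⌊n/2⌋≤⌈n/2⌉ n) ⟩
    h + ⌈ n /2⌉        ≡⟨ ⌊n/2⌋+⌈n/2⌉≡n n ⟩
    n                  ∎
    where
    open ≤-Reasoning
    h = ⌊ n /2⌋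
    ⌊log₂n⌋≡1+⌊log₂h⌋ : ⌊log₂ n ⌋ ≡ 1 + ⌊log₂ h ⌋
    ⌊log₂n⌋≡1+⌊log₂h⌋ = trans (sym (m+[n∸m]≡n (2^k≤n⇒k≤⌊log₂n⌋ {1} {n} (s≤s (s≤s z≤n)))))
                              (cong suc (sym (⌊log₂⌊n/2⌋⌋≡⌊log₂n⌋∸1 n)))

-- logDeficit L t counts the scales i ∈ [1, L] with t < 2 ^ i. It bounds L ∸ ⌊log₂ (1 + t)⌋
-- from above, and unlike that difference it can be summed over items one scale at a time.
logDeficit : ℕ → ℕ → ℕ
logDeficit zero    t = 0
logDeficit (suc L) t = 𝟙 (t <ᵇ 2 ^ suc L) + logDeficit L t

≤⌊log₂[1+t]⌋+logDeficit : ∀ L t → L ≤ ⌊log₂ (suc t) ⌋ + logDeficit L t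
≤⌊log₂[1+t]⌋+logDeficit zero    t = z≤n
≤⌊log₂[1+t]⌋+logDeficit (suc L) t with t <ᵇ 2 ^ suc L in t<ᵇ2^L
... | true  = subst (suc L ≤_) (sym (+-suc _ _)) (s≤s (≤⌊log₂[1+t]⌋+logDeficit L t))
... | false = ≤-trans (2^k≤n⇒k≤⌊log₂n⌋ (m≤n⇒m≤1+n 2^L≤t)) (m≤m+n _ _)
  where
  2^L≤t : 2 ^ suc L ≤ t
  2^L≤t = ≮⇒≥ (λ t<2^L → subst T t<ᵇ2^L (<⇒<ᵇ t<2^L))

module _ {a} {A : Set a} {f : A → ℕ} (f-injective : Injective _≡_ _≡_ f) (P : A → Bool) where

  sumWhere-𝟙[≡ᵇ]≤1 : ∀ m {xs} → Unique xs → sumWhere P (λ x → 𝟙 (f x ≡ᵇ m)) xs ≤ 1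
  sumWhere-𝟙[≡ᵇ]≤1 m []                               = z≤n
  sumWhere-𝟙[≡ᵇ]≤1 m {x ∷ xs} (x∉xs ∷ xs-unique) with P x | f x ≡ᵇ m in fx≡ᵇm
  ... | false | _     = sumWhere-𝟙[≡ᵇ]≤1 m xs-unique
  ... | true  | false = sumWhere-𝟙[≡ᵇ]≤1 m xs-unique
  ... | true  | true  = ≤-reflexive (cong suc (sumWhere-zero P (All.map others≢m x∉xs)))
    where
    fx≡m : f x ≡ m
    fx≡m = ≡ᵇ⇒≡ (f x) m (subst T (sym fx≡ᵇm) _)

    others≢m : ∀ {y} → x ≢ y → 𝟙 (f y ≡ᵇ m) ≡ 0
    others≢m x≢y = 𝟙-¬T (λ fy≡m → x≢y (f-injective (trans fx≡m (sym (≡ᵇ⇒≡ _ m fy≡m)))))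

  sumWhere-𝟙[<ᵇ]≤ : ∀ m {xs} → Unique xs → sumWhere P (λ x → 𝟙 (f x <ᵇ m)) xs ≤ m
  sumWhere-𝟙[<ᵇ]≤ zero    {xs} _ =
    ≤-reflexive (sumWhere-zero P (All.universal (λ _ → refl) xs))
  sumWhere-𝟙[<ᵇ]≤ (suc m) {xs} xs-unique = begin
    sumWhere P (λ x → 𝟙 (f x <ᵇ suc m)) xs
      ≤⟨ sumWhere-mono-≤ P (λ x → ≤-reflexive (𝟙[<ᵇ1+] (f x) m)) xs ⟩
    sumWhere P (λ x → 𝟙 (f x <ᵇ m) + 𝟙 (f x ≡ᵇ m)) xs
      ≡⟨ sumWhere-+ P _ _ xs ⟩
    sumWhere P (λ x → 𝟙 (f x <ᵇ m)) xs + sumWhere P (λ x → 𝟙 (f x ≡ᵇ m)) xs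
      ≤⟨ +-mono-≤ (sumWhere-𝟙[<ᵇ]≤ m xs-unique) (sumWhere-𝟙[≡ᵇ]≤1 m xs-unique) ⟩
    m + 1
      ≡⟨ +-comm m 1 ⟩
    suc m ∎
    where open ≤-Reasoning

  sumWhere-logDeficit≤ : ∀ L {xs} → Unique xs →
                         sumWhere P (λ x → logDeficit L (f x)) xs ≤ 2 ^ suc L
  sumWhere-logDeficit≤ zero    {xs} _ =
    ≤-trans (≤-reflexive (sumWhere-zero P (All.universal (λ _ → refl) xs))) z≤n
  sumWhere-logDeficit≤ (suc L) {xs} xs-unique = begin
    sumWhere P (λ x → logDeficit (suc L) (f x)) xs
      ≡⟨ sumWhere-+ P (λ x → 𝟙 (f x <ᵇ 2 ^ suc L)) (λ x → logDeficit L (f x)) xs ⟩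
    sumWhere P (λ x → 𝟙 (f x <ᵇ 2 ^ suc L)) xs + sumWhere P (λ x → logDeficit L (f x)) xs
      ≤⟨ +-mono-≤ (sumWhere-𝟙[<ᵇ]≤ (2 ^ suc L) xs-unique) (sumWhere-logDeficit≤ L xs-unique) ⟩
    2 ^ suc L + 2 ^ suc L
      ≡⟨ cong (2 ^ suc L +_) (sym (+-identityʳ _)) ⟩
    2 ^ suc (suc L) ∎
    where open ≤-Reasoning

[m+n]∸[o+p]≡[m∸o]+[n∸p] : ∀ {m n o p} → o ≤ m → p ≤ n → (m + n) ∸ (o + p) ≡ (m ∸ o) + (n ∸ p)
[m+n]∸[o+p]≡[m∸o]+[n∸p] {m} z≤n       p≤n = +-∸-assoc m p≤n
[m+n]∸[o+p]≡[m∸o]+[n∸p]     (s≤s o≤m) p≤n = [m+n]∸[o+p]≡[m∸o]+[n∸p] o≤m p≤n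

module _ {n} (a b : Fin n → Fin n) (x : Fin n) where

  ubPop≤ubTerm : ∀ {y} → rank b y <ℕ rank b x → ubPop a b x ≤ ubTerm a b x y
  ubPop≤ubTerm {y} by<bx =
    fromMaybe-≤ 1 (minᴹ-≤-∈ (∈-mapWhere⁺ {P = λ z → rank b z <ᵇ rank b x} {g = ubTerm a b x}
                                          (∈-allFin y) (<⇒<ᵇ by<bx)))

  ubPop≤ : ∀ {B} → 1 ≤ B → (∀ y → ubTerm a b x y ≤ B) → ubPop a b x ≤ B
  ubPop≤ 1≤B ubTerm≤B =
    fromMaybe-minᴹ-≤ (mapWhere (λ y → rank b y <ᵇ rank b x) (ubTerm a b x) (allFin n))
                     1≤B (All-mapWhere⁺ ubTerm≤B (allFin n))

  ℓ≡0⊎dominated : ℓ a b x ≡ 0 ⊎ ∃[ y ] ( rank a y <ℕ rank a x × rank b y <ℕ rank b x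
                                       × ℓ a b x ≡ rank a y + rank b y)
  ℓ≡0⊎dominated
    with maxWhere≡0⊎attained (λ y → (rank a y <ᵇ rank a x) ∧ (rank b y <ᵇ rank b x))
                             (λ y → rank a y + rank b y) (allFin n)
  ... | inj₁ ℓ≡0                     = inj₁ ℓ≡0
  ... | inj₂ (y , y-dominated , ℓ≡) with Equivalence.to T-∧ y-dominated
  ...   | ay<ᵇax , by<ᵇbx = inj₂ (y , <ᵇ⇒< _ _ ay<ᵇax , <ᵇ⇒< _ _ by<ᵇbx , ℓ≡)

  ubPop-dominated : ∀ {y} → rank a y <ℕ rank a x → rank b y <ℕ rank b x →
                    ℓ a b x ≡ rank a y + rank b y → ubPop a b x ≤ newPop a b x + newPop a b x
  ubPop-dominated {y} ay<ax by<bx ℓ≡ = begin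
    ubPop a b x                         ≤⟨ ubPop≤ubTerm by<bx ⟩
    1 + ⌊log₂ Δa ⌋ + ⌊log₂ Δb ⌋         ≤⟨ +-mono-≤ (+-monoʳ-≤ 1 (⌊log₂⌋-mono-≤ Δa≤gap))
                                                    (⌊log₂⌋-mono-≤ Δb≤gap) ⟩
    1 + ⌊log₂ gap ⌋ + ⌊log₂ gap ⌋       ≤⟨ +-monoʳ-≤ (1 + ⌊log₂ gap ⌋) (n≤1+n _) ⟩
    newPop a b x + newPop a b x         ∎
    where
    open ≤-Reasoning
    Δa = ∣ rank a x - rank a y ∣
    Δb = rank b x ∸ rank b y
    gap = r a b x ∸ ℓ a b x
    gap≡ : gap ≡ (rank a x ∸ rank a y) + Δb
    gap≡ = trans (cong (r a b x ∸_) ℓ≡) ([m+n]∸[o+p]≡[m∸o]+[n∸p] (<⇒≤ ay<ax) (<⇒≤ by<bx))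
    Δa≤gap : Δa ≤ gap
    Δa≤gap = subst₂ _≤_ (sym (m≤n⇒∣n-m∣≡n∸m (<⇒≤ ay<ax))) (sym gap≡)
                        (m≤m+n (rank a x ∸ rank a y) Δb)
    Δb≤gap : Δb ≤ gap
    Δb≤gap = subst (Δb ≤_) (sym gap≡) (m≤n+m Δb (rank a x ∸ rank a y))

  ubPop-undominated : ℓ a b x ≡ 0 →
    ubPop a b x ≤ newPop a b x + newPop a b x + logDeficit ⌊log₂ n ⌋ (toℕ (b x))
  ubPop-undominated ℓ≡0 = begin
    ubPop a b x           ≤⟨ ubPop≤ (s≤s z≤n) ubTerm≤ ⟩
    1 + L + lb            ≤⟨ +-monoˡ-≤ lb (+-monoʳ-≤ 1 (≤⌊log₂[1+t]⌋+logDeficit L (toℕ (b x)))) ⟩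
    1 + (lb + d) + lb     ≤⟨ +-mono-≤ (+-monoʳ-≤ 1 (+-monoˡ-≤ d lb≤g)) lb≤g ⟩
    1 + (g + d) + g       ≤⟨ n≤1+n _ ⟩
    suc (1 + (g + d) + g) ≡⟨ rearrange g d ⟩
    (1 + g) + (1 + g) + d ∎
    where
    open ≤-Reasoning
    L  = ⌊log₂ n ⌋
    d  = logDeficit L (toℕ (b x))
    lb = ⌊log₂ (rank b x) ⌋
    g  = ⌊log₂ (r a b x ∸ ℓ a b x) ⌋
    Δa≤n : ∀ y → ∣ rank a x - rank a y ∣ ≤ n
    Δa≤n y = ≤-trans (∣m-n∣≤m⊔n (rank a x) (rank a y)) (⊔-lub (toℕ<n (a x)) (toℕ<n (a y)))
    ubTerm≤ : ∀ y → ubTerm a b x y ≤ 1 + L + lb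
    ubTerm≤ y = +-mono-≤ (+-monoʳ-≤ 1 (⌊log₂⌋-mono-≤ (Δa≤n y)))
                         (⌊log₂⌋-mono-≤ (m∸n≤m (rank b x) (rank b y)))
    lb≤g : lb ≤ g
    lb≤g = ⌊log₂⌋-mono-≤ (subst (λ ℓx → rank b x ≤ r a b x ∸ ℓx) (sym ℓ≡0)
                                (m≤n+m (rank b x) (rank a x)))
    rearrange : ∀ g d → suc (1 + (g + d) + g) ≡ (1 + g) + (1 + g) + d
    rearrange = solve-∀

  ubPop≤newPop+newPop+logDeficit :
    ubPop a b x ≤ newPop a b x + newPop a b x + logDeficit ⌊log₂ n ⌋ (toℕ (b x))
  ubPop≤newPop+newPop+logDeficit with ℓ≡0⊎dominated
  ... | inj₁ ℓ≡0                      = ubPop-undominated ℓ≡0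
  ... | inj₂ (_ , ay<ax , by<bx , ℓ≡) = ≤-trans (ubPop-dominated ay<ax by<bx ℓ≡) (m≤m+n _ _)

ubPop-total≤3*newPop-total : ∀ {n} (a b : Fin n → Fin n) → Injective _≡_ _≡_ b → ∀ P →
                             n + Σ[ P ∣ ubPop a b ] ≤ 3 * (n + Σ[ P ∣ newPop a b ])
ubPop-total≤3*newPop-total {zero}      a b _           P = z≤n
ubPop-total≤3*newPop-total {n@(suc _)} a b b-injective P = begin
  n + Σ[ P ∣ ubPop a b ]
    ≤⟨ +-monoʳ-≤ n (sumWhere-mono-≤ P (ubPop≤newPop+newPop+logDeficit a b) (allFin n)) ⟩
  n + sumWhere P (λ x → newPop a b x + newPop a b x + d x) (allFin n)
    ≡⟨ cong (n +_) (trans (sumWhere-+ P _ d (allFin n)) (cong (_+ D) (sumWhere-+ P _ _ (allFin n)))) ⟩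
  n + (N + N + D)
    ≤⟨ +-monoʳ-≤ n (+-monoʳ-≤ (N + N) D≤2n) ⟩
  n + (N + N + 2 * n)
    ≤⟨ m≤m+n _ N ⟩
  n + (N + N + 2 * n) + N
    ≡⟨ rearrange n N ⟩
  3 * (n + N) ∎
  where
  open ≤-Reasoning
  L = ⌊log₂ n ⌋
  d : Fin n → ℕ
  d x = logDeficit L (toℕ (b x))
  D = sumWhere P d (allFin n)
  N = Σ[ P ∣ newPop a b ]
  D≤2n : D ≤ 2 * n
  D≤2n = ≤-trans (sumWhere-logDeficit≤ (λ e → b-injective (toℕ-injective e)) P L (allFin⁺ n))
                 (*-monoʳ-≤ 2 (2^⌊log₂n⌋≤n n z<s))
  rearrange : ∀ n N → n + (N + N + 2 * n) + N ≡ 3 * (n + N)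
  rearrange = solve-∀

lemma9 : ∃ λ (C : ℕ) →
  ∀ (n : ℕ) (E : Fin n → Fin n → Set) (a b : Fin n → Fin n) →
  Injective _≡_ _≡_ a →
  Injective _≡_ _≡_ b →
  (∀ x y → E x y → a x < a y) →
  (∀ x y → E x y → b x < b y) →
  ∀ (k : ℕ) → k ≤ n →
  n + Σ[ poppedBy b k ∣ ubPop a b ] ≤ C * (n + Σ[ poppedBy b k ∣ newPop a b ])
lemma9 = 3 , λ n _ a b _ b-injective _ _ k _ →
  ubPop-total≤3*newPop-total a b b-injective (poppedBy b k)
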